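{- Let $\mathcal{B}$ be a transitive binary relation on $SC$, and let $\sigma_1,\sigma_2,\rho\in SC$ with $\sigma_1\sqsubseteq^{\mathcal{B}}_{\mathrm{syn}}\sigma_2$ and $\rho\models_{\mathcal{B}}\sigma_1$. If $\rho\mid\sigma_2$ has no $\tau$-transition with respect to $\mathcal{B}$, then $\rho\xrightarrow{\mathsf{ok}}$ and $\sigma_2\xrightarrow{\mathsf{ok}}$.
   Context: Fix a set $BT$ of base types with a preorder $\le_:$ and a countable set of labels. Contract terms: $\sigma ::= \mathbf{1} \mid ?t.\sigma \mid !t.\sigma \mid ?(\sigma').\sigma \mid !(\sigma').\sigma \mid \sum_{i\in I} ?l_i.\sigma_i \mid \bigoplus_{i\in I} !l_i.\sigma_i \mid \mu x.\sigma \mid x$ ($t\in BT$, $I$ finite nonempty, labels pairwise distinct; $!l.\sigma$ is the one-summand internal sum). A term is guarded if for every subterm $\mu x.\sigma$, every occurrence of $x$ in $\sigma$ lies under a constructor other than $\mu$; $SC$ is the set of closed guarded terms. Actions: $\mathsf{Act}=\{?l,!l\}\cup\{?t,!t\}\cup\{?(\sigma),!(\sigma):\sigma\in SC\}$. Transitions: $\mathbf{1}\xrightarrow{\mathsf{ok}}$; $\lambda.\sigma\xrightarrow{\lambda}\sigma$ for a prefix $\lambda\in\mathsf{Act}$; $\sum_{i\in I}?l_i.\sigma_i\xrightarrow{?l_k}\sigma_k$; $\bigoplus_{i\in I}!l_i.\sigma_i\xrightarrow{\tau}!l_k.\sigma_k$ when $|I|>1$; $\mu x.\sigma\xrightarrow{\tau}\sigma\{\mu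 x.\sigma/x\}$; nothing else. $\lambda_1\bowtie_{\mathcal{B}}\lambda_2$ iff $(\lambda_1,\lambda_2)$ is $(!l,?l)$, $(?l,!l)$, $(!t_1,?t_2)$ with $t_1\le_:t_2$, $(?t_1,!t_2)$ with $t_2\le_:t_1$, $(!(\sigma_1),?(\sigma_2))$ with $\sigma_1\mathcal{B}\sigma_2$, or $(?(\sigma_1),!(\sigma_2))$ with $\sigma_2\mathcal{B}\sigma_1$. $\rho\mid\sigma\xrightarrow{\tau}_{\mathcal{B}}\rho'\mid\sigma'$ iff $\rho\xrightarrow{\tau}\rho'$, $\sigma'=\sigma$; or $\sigma\xrightarrow{\tau}\sigma'$, $\rho'=\rho$; or $\rho\xrightarrow{\lambda_1}\rho'$, $\sigma\xrightarrow{\lambda_2}\sigma'$, $\lambda_1\bowtie_{\mathcal{B}}\lambda_2$. $\models_{\mathcal{B}}$ is the largest relation $R$ on $SC$ such that whenever $\rho R\sigma$: (i) if $\rho\mid\sigma$ has no $\tau$-transition w.r.t. $\mathcal{B}$ then $\rho\xrightarrow{\mathsf{ok}}$, $\sigma\xrightarrow{\mathsf{ok}}$; (ii) $\rho\mid\sigma\xrightarrow{\tau}_{\mathcal{B}}\rho'\mid\sigma'$ implies $\rho'R\sigma'$. $\mathrm{unfold}(\mu x.\sigma)=\mathrm{unfold}(\sigma\{\mu x.\sigma/x\})$, $\mathrm{unfold}(\sigma)=\sigma$ otherwise. For relations $R,\mathcal{B}$, $\mathcal{F}(R,\mathcal{B})$ is the set of pairs $(\sigma_1,\sigma_2)$ such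 that: (i) if $\mathrm{unfold}(\sigma_1)=\mathbf{1}$ then $\mathrm{unfold}(\sigma_2)=\mathbf{1}$; (ii) if $\mathrm{unfold}(\sigma_1)=?t_1.\sigma_1'$ then $\mathrm{unfold}(\sigma_2)=?t_2.\sigma_2'$, $\sigma_1'R\sigma_2'$, $t_1\le_:t_2$; (iii) if $\mathrm{unfold}(\sigma_1)=!t_1.\sigma_1'$ then $\mathrm{unfold}(\sigma_2)=!t_2.\sigma_2'$, $\sigma_1'R\sigma_2'$, $t_2\le_:t_1$; (iv) if $\mathrm{unfold}(\sigma_1)=!(\sigma_1^m).\sigma_1'$ then $\mathrm{unfold}(\sigma_2)=!(\sigma_2^m).\sigma_2'$, $\sigma_1'R\sigma_2'$, $\sigma_2^m\mathcal{B}\sigma_1^m$; (v) if $\mathrm{unfold}(\sigma_1)=?(\sigma_1^m).\sigma_1'$ then $\mathrm{unfold}(\sigma_2)=?(\sigma_2^m).\sigma_2'$, $\sigma_1'R\sigma_2'$, $\sigma_1^m\mathcal{B}\sigma_2^m$; (vi) if $\mathrm{unfold}(\sigma_1)=\sum_{i\in I}?l_i.\sigma^1_i$ then $\mathrm{unfold}(\sigma_2)=\sum_{j\in J}?l_j.\sigma^2_j$, $I\subseteq J$, $\sigma^1_iR\sigma^2_i$ ($i\in I$); (vii) if $\mathrm{unfold}(\sigma_1)=\bigoplus_{i\in I}!l_i.\sigma^1_i$ then $\mathrm{unfold}(\sigma_2)=\bigoplus_{j\in J}!l_j.\sigma^2_j$, $J\subseteq I$, $\sigma^1_jR\sigma^2_j$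 ($j\in J$). $\sqsubseteq^{\mathcal{B}}_{\mathrm{syn}}$ is the greatest $R$ with $R\subseteq\mathcal{F}(R,\mathcal{B})$. -}

module Defs where

open import Data.Nat using (ℕ; _≟_)
open import Data.Product using (Σ; _×_; _,_; ∃)
open import Data.Unit using (⊤)
open import Data.Empty using (⊥)
open import Data.List using (List; []; _∷_)
open import Data.List.Membership.Propositional using (_∈_)
open import Data.List.Relation.Unary.Unique.Propositional using (Unique)
open import Relation.Nullary using (¬_; yes; no)
open import Relation.Binary.PropositionalEquality using (_≡_)

Label : Set
Label = ℕ

Var : Set
Var = ℕ

mutual
  data Contract (BT : Set) : Set where
    one   : Contract BT
    inT   : BT → Contract BT → Contract BT
    outT  : BT → Contract BT → Contract BT
    inD   : Contract BT → Contract BT → Contract BT      -- ?(σ').σ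
    outD  : Contract BT → Contract BT → Contract BT      -- !(σ').σ
    ext   : Branches BT → Contract BT                    -- Σ_{i∈I} ?l_i.σ_i
    int   : Branches BT → Contract BT                    -- ⊕_{i∈I} !l_i.σ_i
    mu    : Var → Contract BT → Contract BT
    var   : Var → Contract BT

  data Branches (BT : Set) : Set where
    [_↦_]   : Label → Contract BT → Branches BT
    _↦_∷_   : Label → Contract BT → Branches BT → Branches BT

module _ {BT : Set} where

  data _∈B_ : Label × Contract BT → Branches BT → Set where
    here₁ : ∀ {l σ} → (l , σ) ∈B [ l ↦ σ ]
    here  : ∀ {l σ bs} → (l , σ) ∈B (l ↦ σ ∷ bs)
    there : ∀ {l σ l' σ' bs} → (l , σ) ∈B bs → (l , σ) ∈B (l' ↦ σ' ∷ bs)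

  labels : Branches BT → List Label
  labels [ l ↦ _ ] = l ∷ []
  labels (l ↦ _ ∷ bs) = l ∷ labels bs

  -- Substitution σ{τ/x} (only ever used with τ closed, so no capture)

  mutual
    _[_≔_] : Contract BT → Var → Contract BT → Contract BT
    one [ x ≔ τ ] = one
    inT t σ [ x ≔ τ ] = inT t (σ [ x ≔ τ ])
    outT t σ [ x ≔ τ ] = outT t (σ [ x ≔ τ ])
    inD σ' σ [ x ≔ τ ] = inD (σ' [ x ≔ τ ]) (σ [ x ≔ τ ])
    outD σ' σ [ x ≔ τ ] = outD (σ' [ x ≔ τ ]) (σ [ x ≔ τ ])
    ext bs [ x ≔ τ ] = ext (substB bs x τ)
    int bs [ x ≔ τ ] = int (substB bs x τ)
    mu y σ [ x ≔ τ ] with x ≟ y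
    ... | yes _ = mu y σ
    ... | no _ = mu y (σ [ x ≔ τ ])
    var y [ x ≔ τ ] with x ≟ y
    ... | yes _ = τ
    ... | no _ = var y

    substB : Branches BT → Var → Contract BT → Branches BT
    substB [ l ↦ σ ] x τ = [ l ↦ σ [ x ≔ τ ] ]
    substB (l ↦ σ ∷ bs) x τ = l ↦ σ [ x ≔ τ ] ∷ substB bs x τ

  mutual
    ClosedUnder : List Var → Contract BT → Set
    ClosedUnder Γ one = ⊤
    ClosedUnder Γ (inT t σ) = ClosedUnder Γ σ
    ClosedUnder Γ (outT t σ) = ClosedUnder Γ σ
    ClosedUnder Γ (inD σ' σ) = ClosedUnder Γ σ' × ClosedUnder Γ σ
    ClosedUnder Γ (outD σ' σ) = ClosedUnder Γ σ' × ClosedUnder Γ σ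
    ClosedUnder Γ (ext bs) = ClosedUnderB Γ bs
    ClosedUnder Γ (int bs) = ClosedUnderB Γ bs
    ClosedUnder Γ (mu x σ) = ClosedUnder (x ∷ Γ) σ
    ClosedUnder Γ (var x) = x ∈ Γ

    ClosedUnderB : List Var → Branches BT → Set
    ClosedUnderB Γ [ l ↦ σ ] = ClosedUnder Γ σ
    ClosedUnderB Γ (l ↦ σ ∷ bs) = ClosedUnder Γ σ × ClosedUnderB Γ bs

  Closed : Contract BT → Set
  Closed = ClosedUnder []

  -- every free occurrence of x in σ lies under a constructor other than μ
  GuardedIn : Var → Contract BT → Set
  GuardedIn x (mu y σ) with x ≟ y
  ... | yes _ = ⊤
  ... | no _ = GuardedIn x σ
  GuardedIn x (var y) = ¬ (x ≡ y)
  GuardedIn x _ = ⊤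

  mutual
    Guarded : Contract BT → Set
    Guarded one = ⊤
    Guarded (inT t σ) = Guarded σ
    Guarded (outT t σ) = Guarded σ
    Guarded (inD σ' σ) = Guarded σ' × Guarded σ
    Guarded (outD σ' σ) = Guarded σ' × Guarded σ
    Guarded (ext bs) = GuardedB bs
    Guarded (int bs) = GuardedB bs
    Guarded (mu x σ) = GuardedIn x σ × Guarded σ
    Guarded (var x) = ⊤

    GuardedB : Branches BT → Set
    GuardedB [ l ↦ σ ] = Guarded σ
    GuardedB (l ↦ σ ∷ bs) = Guarded σ × GuardedB bs

  mutual
    WF : Contract BT → Set
    WF one = ⊤
    WF (inT t σ) = WF σ
    WF (outT t σ) = WF σ
    WF (inD σ' σ) = WF σ' × WF σ
    WF (outD σ' σ) = WF σ' × WF σ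
    WF (ext bs) = Unique (labels bs) × WFB bs
    WF (int bs) = Unique (labels bs) × WFB bs
    WF (mu x σ) = WF σ
    WF (var x) = ⊤

    WFB : Branches BT → Set
    WFB [ l ↦ σ ] = WF σ
    WFB (l ↦ σ ∷ bs) = WF σ × WFB bs

  SC : Contract BT → Set
  SC σ = Closed σ × Guarded σ × WF σ

  data Act : Set where
    inL outL : Label → Act
    inTy outTy : BT → Act
    inDel outDel : Contract BT → Act

  data Lab : Set where
    ok : Lab
    τ  : Lab
    act : Act → Lab

  data _—[_]→_ : Contract BT → Lab → Contract BT → Set where
    ok-one  : one —[ ok ]→ one
    pre-inT : ∀ {t σ} → inT t σ —[ act (inTy t) ]→ σ
    pre-outT : ∀ {t σ} → outT t σ —[ act (outTy t) ]→ σ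
    pre-inD : ∀ {σ' σ} → inD σ' σ —[ act (inDel σ') ]→ σ
    pre-outD : ∀ {σ' σ} → outD σ' σ —[ act (outDel σ') ]→ σ
    -- !l.σ is the one-summand internal sum
    pre-outL : ∀ {l σ} → int [ l ↦ σ ] —[ act (outL l) ]→ σ
    ext-sel : ∀ {bs l σ} → (l , σ) ∈B bs → ext bs —[ act (inL l) ]→ σ
    -- internal choice when |I| > 1
    int-sel : ∀ {l₀ σ₀ bs l σ} → (l , σ) ∈B (l₀ ↦ σ₀ ∷ bs) →
              int (l₀ ↦ σ₀ ∷ bs) —[ τ ]→ int [ l ↦ σ ]
    unf : ∀ {x σ} → mu x σ —[ τ ]→ (σ [ x ≔ mu x σ ])

  HasOk : Contract BT → Set
  HasOk σ = ∃ λ σ' → σ —[ ok ]→ σ'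

Rel : Set → Set₁
Rel BT = Contract BT → Contract BT → Set

OnSC : {BT : Set} → Rel BT → Set
OnSC R = ∀ {x y} → R x y → SC x × SC y

module _ {BT : Set} (_≤_ : BT → BT → Set) (B : Rel BT) where

  data _⋈_ : Act {BT} → Act {BT} → Set where
    m-out-in-L : ∀ {l} → outL l ⋈ inL l
    m-in-out-L : ∀ {l} → inL l ⋈ outL l
    m-out-in-T : ∀ {t₁ t₂} → t₁ ≤ t₂ → outTy t₁ ⋈ inTy t₂
    m-in-out-T : ∀ {t₁ t₂} → t₂ ≤ t₁ → inTy t₁ ⋈ outTy t₂
    m-out-in-D : ∀ {σ₁ σ₂} → B σ₁ σ₂ → outDel σ₁ ⋈ inDel σ₂
    m-in-out-D : ∀ {σ₁ σ₂} → B σ₂ σ₁ → inDel σ₁ ⋈ outDel σ₂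

  data Step : Contract BT → Contract BT → Contract BT → Contract BT → Set where
    step-l : ∀ {ρ ρ' σ} → ρ —[ τ ]→ ρ' → Step ρ σ ρ' σ
    step-r : ∀ {ρ σ σ'} → σ —[ τ ]→ σ' → Step ρ σ ρ σ'
    sync   : ∀ {ρ ρ' σ σ' a₁ a₂} → ρ —[ act a₁ ]→ ρ' → σ —[ act a₂ ]→ σ' →
             a₁ ⋈ a₂ → Step ρ σ ρ' σ'

  Stuck : Contract BT → Contract BT → Set
  Stuck ρ σ = ∀ ρ' σ' → ¬ Step ρ σ ρ' σ'

  IsCompliance : Rel BT → Set
  IsCompliance R =
    OnSC R ×
    (∀ {ρ σ} → R ρ σ →
       (Stuck ρ σ → HasOk ρ × HasOk σ) ×
       (∀ {ρ' σ'} → Step ρ σ ρ' σ' → R ρ' σ'))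

  -- ρ ⊨_B σ : the largest compliance relation (union of all of them)
  _⊨_ : Contract BT → Contract BT → Set₁
  ρ ⊨ σ = Σ (Rel BT) λ R → IsCompliance R × R ρ σ

-- unfold, given as the (inductive) graph of its defining equations:
-- Unfolds σ u  iff  unfold(σ) = u.

data Unfolds {BT : Set} : Contract BT → Contract BT → Set where
  unf-mu : ∀ {x σ u} → Unfolds (σ [ x ≔ mu x σ ]) u → Unfolds (mu x σ) u
  unf-one : Unfolds one one
  unf-inT : ∀ {t σ} → Unfolds (inT t σ) (inT t σ)
  unf-outT : ∀ {t σ} → Unfolds (outT t σ) (outT t σ)
  unf-inD : ∀ {σ' σ} → Unfolds (inD σ' σ) (inD σ' σ)
  unf-outD : ∀ {σ' σ} → Unfolds (outD σ' σ) (outD σ' σ)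
  unf-ext : ∀ {bs} → Unfolds (ext bs) (ext bs)
  unf-int : ∀ {bs} → Unfolds (int bs) (int bs)
  unf-var : ∀ {x} → Unfolds (var x) (var x)

module _ {BT : Set} (_≤_ : BT → BT → Set) where

  F : Rel BT → Rel BT → Contract BT → Contract BT → Set
  F R B σ₁ σ₂ =
    (Unfolds σ₁ one → Unfolds σ₂ one) ×
    (∀ {t₁ σ₁'} → Unfolds σ₁ (inT t₁ σ₁') →
       Σ BT λ t₂ → Σ (Contract BT) λ σ₂' →
         Unfolds σ₂ (inT t₂ σ₂') × R σ₁' σ₂' × t₁ ≤ t₂) ×
    (∀ {t₁ σ₁'} → Unfolds σ₁ (outT t₁ σ₁') →
       Σ BT λ t₂ → Σ (Contract BT) λ σ₂' →
         Unfolds σ₂ (outT t₂ σ₂') × R σ₁' σ₂' × t₂ ≤ t₁) ×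
    (∀ {m₁ σ₁'} → Unfolds σ₁ (outD m₁ σ₁') →
       Σ (Contract BT) λ m₂ → Σ (Contract BT) λ σ₂' →
         Unfolds σ₂ (outD m₂ σ₂') × R σ₁' σ₂' × B m₂ m₁) ×
    (∀ {m₁ σ₁'} → Unfolds σ₁ (inD m₁ σ₁') →
       Σ (Contract BT) λ m₂ → Σ (Contract BT) λ σ₂' →
         Unfolds σ₂ (inD m₂ σ₂') × R σ₁' σ₂' × B m₁ m₂) ×
    (∀ {bs₁} → Unfolds σ₁ (ext bs₁) →
       Σ (Branches BT) λ bs₂ → Unfolds σ₂ (ext bs₂) ×
         (∀ {l c₁} → (l , c₁) ∈B bs₁ →
            Σ (Contract BT) λ c₂ → (l , c₂) ∈B bs₂ × R c₁ c₂)) ×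
    (∀ {bs₁} → Unfolds σ₁ (int bs₁) →
       Σ (Branches BT) λ bs₂ → Unfolds σ₂ (int bs₂) ×
         (∀ {l c₂} → (l , c₂) ∈B bs₂ →
            Σ (Contract BT) λ c₁ → (l , c₁) ∈B bs₁ × R c₁ c₂))

  -- σ₁ ⊑^B_syn σ₂ : greatest R (on SC) with R ⊆ F(R, B)
  SynSub : Rel BT → Contract BT → Contract BT → Set₁
  SynSub B σ₁ σ₂ =
    Σ (Rel BT) λ R → OnSC R × (∀ {x y} → R x y → F R B x y) × R σ₁ σ₂

-- Unfold σ₁ to its head u; ρ still complies with u, because τ-steps of the right-hand
-- contract preserve compliance. The syntactic subcontract clauses then say that, after
-- resolving an internal choice of u towards the single branch offered by the τ-final σ₂,
-- every action of u that could synchronise with ρ is matched (using transitivity of ≤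
-- and of B) by an action of σ₂. Hence ρ is stuck against that residual as well, and
-- compliance yields ok for ρ and for the residual, which is then 1, forcing σ₂ = 1.
module Submission where

open import Defs
open import Data.Product using (_×_)
open import Relation.Binary.PropositionalEquality using (_≡_)
open import Relation.Binary.Structures using (IsPreorder)
open import Relation.Binary.Definitions using (Transitive)

open import Data.Nat using (ℕ; zero; suc; _≟_)
open import Data.Product using (∃; ∃₂; _,_; proj₁; proj₂)
open import Data.Empty using (⊥-elim)
open import Data.List using ([]; _∷_)
open import Data.List.Relation.Unary.Any using (here; there)
open import Data.List.Membership.Propositional using (_∈_)
open import Relation.Nullary using (¬_; yes; no)
open import Relation.Binary.PropositionalEquality using (refl)

module _ {BT : Set} where

  TauFinal : Contract BT → Set
  TauFinal σ = ∀ σ' → ¬ σ —[ τ ]→ σ'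

  τ-Invariant : (Contract BT → Set) → Set
  τ-Invariant P = ∀ {σ σ'} → σ —[ τ ]→ σ' → P σ → P σ'

  data Head : Contract BT → Set where
    one  : Head one
    inT  : ∀ {t σ} → Head (inT t σ)
    outT : ∀ {t σ} → Head (outT t σ)
    inD  : ∀ {σ' σ} → Head (inD σ' σ)
    outD : ∀ {σ' σ} → Head (outD σ' σ)
    ext  : ∀ {bs} → Head (ext bs)
    int  : ∀ {bs} → Head (int bs)

  Head-subst : ∀ {σ} x t → Head σ → Head (σ [ x ≔ t ])
  Head-subst x t one  = one
  Head-subst x t inT  = inT
  Head-subst x t outT = outT
  Head-subst x t inD  = inD
  Head-subst x t outD = outD
  Head-subst x t ext  = ext
  Head-subst x t int  = int

  Head-unfolds : ∀ {σ} → Head σ → Unfolds σ σ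
  Head-unfolds one  = unf-one
  Head-unfolds inT  = unf-inT
  Head-unfolds outT = unf-outT
  Head-unfolds inD  = unf-inD
  Head-unfolds outD = unf-outD
  Head-unfolds ext  = unf-ext
  Head-unfolds int  = unf-int

  -- The index is the measure on which unfolding terminates.
  data MuSpine : ℕ → Contract BT → Set where
    head : ∀ {σ} → Head σ → MuSpine zero σ
    mu   : ∀ {n x σ} → MuSpine n σ → MuSpine (suc n) (mu x σ)

  MuSpine-subst : ∀ {n σ} x t → MuSpine n σ → MuSpine n (σ [ x ≔ t ])
  MuSpine-subst x t (head h) = head (Head-subst x t h)
  MuSpine-subst x t (mu {x = y} s) with x ≟ y
  ... | yes _ = mu s
  ... | no _  = mu (MuSpine-subst x t s)

  GuardedIn-under-mu : ∀ {y x} (σ : Contract BT) → ¬ y ≡ x → GuardedIn y (mu x σ) → GuardedIn y σ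
  GuardedIn-under-mu {y} {x} σ y≢x g with y ≟ x
  ... | yes y≡x = ⊥-elim (y≢x y≡x)
  ... | no _    = g

  -- Γ collects the binders passed so far; guardedness forbids the spine to end in one of them.
  guarded⇒MuSpine : ∀ Γ (σ : Contract BT) → ClosedUnder Γ σ → Guarded σ →
                    (∀ {y} → y ∈ Γ → GuardedIn y σ) → ∃ λ n → MuSpine n σ
  guarded⇒MuSpine Γ one         _ _ _ = zero , head one
  guarded⇒MuSpine Γ (inT _ _)   _ _ _ = zero , head inT
  guarded⇒MuSpine Γ (outT _ _)  _ _ _ = zero , head outT
  guarded⇒MuSpine Γ (inD _ _)   _ _ _ = zero , head inD
  guarded⇒MuSpine Γ (outD _ _)  _ _ _ = zero , head outD
  guarded⇒MuSpine Γ (ext _)     _ _ _ = zero , head ext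
  guarded⇒MuSpine Γ (int _)     _ _ _ = zero , head int
  guarded⇒MuSpine Γ (var z) z∈Γ _ guardedΓ = ⊥-elim (guardedΓ z∈Γ refl)
  guarded⇒MuSpine Γ (mu x σ) closed (guarded-x , guarded) guardedΓ
    with guarded⇒MuSpine (x ∷ Γ) σ closed guarded guardedΓ'
    where
    guardedΓ' : ∀ {y} → y ∈ x ∷ Γ → GuardedIn y σ
    guardedΓ' (here refl) = guarded-x
    guardedΓ' {y} (there y∈Γ) with y ≟ x
    ... | yes refl = guarded-x
    ... | no y≢x   = GuardedIn-under-mu σ y≢x (guardedΓ y∈Γ)
  ... | n , spine = suc n , mu spine

  unfold-preserving : ∀ n {σ} → MuSpine n σ → ∀ {P} → τ-Invariant P → P σ →
                      ∃ λ u → Unfolds σ u × Head u × P u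
  unfold-preserving zero (head h) _ p = _ , Head-unfolds h , h , p
  unfold-preserving (suc n) (mu {x = x} {σ = σ} spine) inv p
    with unfold-preserving n (MuSpine-subst x (mu x σ) spine) inv (inv unf p)
  ... | u , σ⇒u , h , pu = u , unf-mu σ⇒u , h , pu

  unfold-SC : ∀ {σ} → SC σ → ∀ {P} → τ-Invariant P → P σ → ∃ λ u → Unfolds σ u × Head u × P u
  unfold-SC {σ} (closed , guarded , _) with guarded⇒MuSpine [] σ closed guarded (λ ())
  ... | n , spine = unfold-preserving n spine

  unfolds-τ-final : ∀ {σ v} → TauFinal σ → Unfolds σ v → σ ≡ v
  unfolds-τ-final final (unf-mu _) = ⊥-elim (final _ unf)
  unfolds-τ-final _ unf-one  = refl
  unfolds-τ-final _ unf-inT  = refl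
  unfolds-τ-final _ unf-outT = refl
  unfolds-τ-final _ unf-inD  = refl
  unfolds-τ-final _ unf-outD = refl
  unfolds-τ-final _ unf-ext  = refl
  unfolds-τ-final _ unf-int  = refl
  unfolds-τ-final _ unf-var  = refl

  int-select : ∀ {P bs l σ} → τ-Invariant P → (l , σ) ∈B bs → P (int bs) → P (int [ l ↦ σ ])
  int-select _   here₁ p = p
  int-select inv l∈bs@here      p = inv (int-sel l∈bs) p
  int-select inv l∈bs@(there _) p = inv (int-sel l∈bs) p

module Stuckness {BT : Set} (_≤_ : BT → BT → Set) (B : Rel BT) where

  Accepts : Contract BT → Act → Set
  Accepts σ a = ∃₂ λ a' σ' → σ —[ act a' ]→ σ' × _⋈_ _≤_ B a a'

  record Covers (σ σ' : Contract BT) : Set where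
    field
      τ-final   : TauFinal σ'
      ok-cover  : HasOk σ' → HasOk σ
      act-cover : ∀ {a} → Accepts σ' a → Accepts σ a

  Covers-refl : ∀ {σ} → TauFinal σ → Covers σ σ
  Covers-refl final = record
    { τ-final = final ; ok-cover = λ ok → ok ; act-cover = λ acc → acc }

  Covers-by-actions : ∀ {σ σ'} → TauFinal σ' → (∀ {σ''} → ¬ σ' —[ ok ]→ σ'') →
                      (∀ {a} → Accepts σ' a → Accepts σ a) → Covers σ σ'
  Covers-by-actions final no-ok act-cover =
    record { τ-final = final
           ; ok-cover = λ (_ , ok-step) → ⊥-elim (no-ok ok-step)
           ; act-cover = act-cover }

  stuck-τ-finalʳ : ∀ {ρ σ} → Stuck _≤_ B ρ σ → TauFinal σ
  stuck-τ-finalʳ stuck σ' step = stuck _ σ' (step-r step)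

  stuck-transfer : ∀ {ρ σ σ'} → Stuck _≤_ B ρ σ → Covers σ σ' → Stuck _≤_ B ρ σ'
  stuck-transfer stuck _ _ _ (step-l ρ-step) = stuck _ _ (step-l ρ-step)
  stuck-transfer _ cover _ _ (step-r σ'-step) = Covers.τ-final cover _ σ'-step
  stuck-transfer stuck cover _ _ (sync ρ-step σ'-step match)
    with Covers.act-cover cover (_ , _ , σ'-step , match)
  ... | _ , _ , σ-step , match' = stuck _ _ (sync ρ-step σ-step match')

  module _ (trans-≤ : Transitive _≤_) (trans-B : Transitive B) {R' : Rel BT} {σ₁ σ₂ : Contract BT}
           (final₂ : TauFinal σ₂) where

    covered-residual : ∀ {P u} → F _≤_ R' B σ₁ σ₂ → τ-Invariant P → Unfolds σ₁ u → Head u → P u →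
                       ∃ λ u' → P u' × Covers σ₂ u'
    covered-residual (sub-one , _) _ σ₁⇒u one p with unfolds-τ-final final₂ (sub-one σ₁⇒u)
    ... | refl = one , p , Covers-refl (λ _ ())
    covered-residual (_ , sub-inT , _) _ σ₁⇒u inT p with sub-inT σ₁⇒u
    ... | _ , _ , σ₂⇒ , _ , t≤t₂ with unfolds-τ-final final₂ σ₂⇒
    ... | refl = _ , p , Covers-by-actions (λ _ ()) (λ ())
      λ { (_ , _ , pre-inT , m-out-in-T t₁≤t) → _ , _ , pre-inT , m-out-in-T (trans-≤ t₁≤t t≤t₂) }
    covered-residual (_ , _ , sub-outT , _) _ σ₁⇒u outT p with sub-outT σ₁⇒u
    ... | _ , _ , σ₂⇒ , _ , t₂≤t with unfolds-τ-final final₂ σ₂⇒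
    ... | refl = _ , p , Covers-by-actions (λ _ ()) (λ ())
      λ { (_ , _ , pre-outT , m-in-out-T t≤t₁) → _ , _ , pre-outT , m-in-out-T (trans-≤ t₂≤t t≤t₁) }
    covered-residual (_ , _ , _ , sub-outD , _) _ σ₁⇒u outD p with sub-outD σ₁⇒u
    ... | _ , _ , σ₂⇒ , _ , m₂Bm with unfolds-τ-final final₂ σ₂⇒
    ... | refl = _ , p , Covers-by-actions (λ _ ()) (λ ())
      λ { (_ , _ , pre-outD , m-in-out-D mBm₁) → _ , _ , pre-outD , m-in-out-D (trans-B m₂Bm mBm₁) }
    covered-residual (_ , _ , _ , _ , sub-inD , _) _ σ₁⇒u inD p with sub-inD σ₁⇒u
    ... | _ , _ , σ₂⇒ , _ , mBm₂ with unfolds-τ-final final₂ σ₂⇒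
    ... | refl = _ , p , Covers-by-actions (λ _ ()) (λ ())
      λ { (_ , _ , pre-inD , m-out-in-D m₁Bm) → _ , _ , pre-inD , m-out-in-D (trans-B m₁Bm mBm₂) }
    covered-residual (_ , _ , _ , _ , _ , sub-ext , _) _ σ₁⇒u ext p with sub-ext σ₁⇒u
    ... | _ , σ₂⇒ , branches⊆ with unfolds-τ-final final₂ σ₂⇒
    ... | refl = _ , p , Covers-by-actions (λ _ ()) (λ ())
      λ { (_ , _ , ext-sel l∈bs , m-out-in-L) →
            _ , _ , ext-sel (proj₁ (proj₂ (branches⊆ l∈bs))) , m-out-in-L }
    -- A τ-final σ₂ offers a single branch !l, so u is first resolved to its l-branch.
    covered-residual (_ , _ , _ , _ , _ , _ , sub-int) inv σ₁⇒u int p with sub-int σ₁⇒u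
    ... | (_ ↦ _ ∷ _) , σ₂⇒ , _ with unfolds-τ-final final₂ σ₂⇒
    ...   | refl = ⊥-elim (final₂ _ (int-sel here))
    covered-residual (_ , _ , _ , _ , _ , _ , sub-int) inv σ₁⇒u int p | [ _ ↦ _ ] , σ₂⇒ , branches⊇
      with unfolds-τ-final final₂ σ₂⇒
    ...   | refl = _ , int-select inv (proj₁ (proj₂ (branches⊇ here₁))) p ,
                   Covers-by-actions (λ _ ()) (λ ())
      λ { (_ , _ , pre-outL , m-in-out-L) → _ , _ , pre-outL , m-in-out-L }

corollary3p12 : {BT : Set} (_≤_ : BT → BT → Set) → IsPreorder _≡_ _≤_ →
                (B : Rel BT) → OnSC B → Transitive B →
                (σ₁ σ₂ ρ : Contract BT) → SC σ₁ → SC σ₂ → SC ρ →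
                SynSub _≤_ B σ₁ σ₂ → _⊨_ _≤_ B ρ σ₁ →
                Stuck _≤_ B ρ σ₂ →
                HasOk ρ × HasOk σ₂
corollary3p12 _≤_ preorder B _ trans-B σ₁ σ₂ ρ sc₁ _ _
              (_ , _ , sub , σ₁⊑σ₂) (R , (_ , compliant) , ρRσ₁) stuck =
  let (u , σ₁⇒u , head-u , ρRu) = unfold-SC sc₁ R-τ-invariant ρRσ₁
      (u' , ρRu' , cover) = covered-residual (IsPreorder.trans preorder) trans-B
                              (stuck-τ-finalʳ stuck) (sub σ₁⊑σ₂) R-τ-invariant σ₁⇒u head-u ρRu
      (ok-ρ , ok-u') = proj₁ (compliant ρRu') (stuck-transfer stuck cover)
  in ok-ρ , Covers.ok-cover cover ok-u'
  where
  open Stuckness _≤_ B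
  R-τ-invariant : τ-Invariant (R ρ)
  R-τ-invariant step ρRσ = proj₂ (compliant ρRσ) (step-r step)
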